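{- Let $G\le\mathrm{Sym}(n)$ and suppose $H=\mathrm{Der}(G)\cup\{1\}$ is a subgroup of $G$. Then $\Gamma_G$ is the disjoint union of $m=|G:H|$ complete graphs $K_{|H|}$, whose vertex sets are the left cosets of $H$ in $G$. Moreover $\mathbf{d}_G\le 1$, and if $G$ is transitive then $H$ is regular and $\mathbf{d}_G=1$; hence any transitive $G$ with this property has the EKR property and is EKR robust.
   Context: A derangement is a permutation with no fixed point; $\mathrm{Der}(G)$ is the set of derangements of $G$; $1$ is the identity. For inverse-closed $S\subseteq G$ not containing the identity, $\mathrm{Cay}(G,S)$ is the graph on $G$ with $g,h$ adjacent iff $g^{ -1}h\in S$; $\Gamma_G=\mathrm{Cay}(G,\mathrm{Der}(G))$; $\alpha$ denotes independence number. A regular group is a transitive group in which no non-identity element fixes a point. $G$ (transitive) has the EKR property if $\alpha(\Gamma_G)=|G|/n$. A label is a set $\{d,d^{ -1}\}$, $d\in\mathrm{Der}(G)$; the number of labels of $D\subseteq\mathrm{Der}(G)$ is $|\{\{d,d^{ -1}\}:d\in D\}|$. For distinct $i,j\in[n]$, $D_{i\to j}=\{d\in\mathrm{Der}(G):d(i)=j\}$, and $\mathbf{d}_G=\min_{i\ne j}|\{\{d,d^{ -1}\}:d\in D_{i\to j}\}|$. $G$ is EKR robust if $\alpha(\mathrm{Cay}(G,\mathrm{Der}(G)\setminus D))=|G|/n$ for every inverse-closed $D\subseteq\mathrm{Der}(G)$ with fewer than $\mathbf{d}_G$ labels. -}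

module Defs where

open import Level using (0ℓ)
open import Data.Nat using (ℕ; _≤_; _<_; _/_; NonZero)
open import Data.Fin using (Fin; _≟_)
open import Data.Fin.Properties using (all?)
open import Data.Vec using (Vec; lookup; tabulate; allFin)
import Data.Vec.Properties as VP
open import Data.List using (List; length; filter; deduplicate; _∷_)
open import Data.List.Membership.Propositional using (_∈_; _∉_)
open import Data.List.Relation.Unary.All using (All)
open import Data.List.Relation.Unary.Unique.Propositional using (Unique)
open import Data.List.Relation.Unary.AllPairs using (AllPairs)
open import Data.Product using (Σ; ∃; _×_; _,_)
open import Data.Sum using (_⊎_)
open import Relation.Nullary using (¬_; Dec; yes; no)
open import Relation.Nullary.Decidable using (_×-dec_; _⊎-dec_; ¬?)
open import Relation.Binary.PropositionalEquality using (_≡_; _≢_)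
open import Relation.Binary.Definitions using (DecidableEquality)

-- Permutations of [n] = Fin n, represented by their image vector
-- p = (p(0), …, p(n-1)).  Elements of Sym(n) are the injective ones.

Perm : ℕ → Set
Perm n = Vec (Fin n) n

_≟ₚ_ : ∀ {n} → DecidableEquality (Perm n)
_≟ₚ_ = VP.≡-dec _≟_

IsPerm : ∀ {n} → Perm n → Set
IsPerm p = ∀ i j → lookup p i ≡ lookup p j → i ≡ j

idP : ∀ {n} → Perm n
idP {n} = allFin n

_∘ₚ_ : ∀ {n} → Perm n → Perm n → Perm n
p ∘ₚ q = tabulate (λ i → lookup p (lookup q i))

-- A permutation group G ≤ Sym(n), given as a duplicate-free list of
-- its elements (so |G| = length G).

record IsPermGroup {n} (G : List (Perm n)) : Set where
  field
    unique : Unique G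
    perms  : All IsPerm G
    id∈    : idP ∈ G
    comp∈  : ∀ {g h} → g ∈ G → h ∈ G → (g ∘ₚ h) ∈ G
    inv∈   : ∀ {g} → g ∈ G → ∃ λ h → h ∈ G × (g ∘ₚ h) ≡ idP

order : ∀ {n} → List (Perm n) → ℕ
order = length

IsTransitive : ∀ {n} → (Perm n → Set) → Set
IsTransitive {n} P = ∀ (i j : Fin n) → ∃ λ g → P g × lookup g i ≡ j

IsDerangement : ∀ {n} → Perm n → Set
IsDerangement p = ∀ i → lookup p i ≢ i

isDerangement? : ∀ {n} (p : Perm n) → Dec (IsDerangement p)
isDerangement? p = all? (λ i → ¬? (lookup p i ≟ i))

InDer : ∀ {n} → List (Perm n) → Perm n → Set
InDer G d = d ∈ G × IsDerangement d

InH : ∀ {n} → List (Perm n) → Perm n → Set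
InH G x = x ≡ idP ⊎ InDer G x

IsSubgroupPred : ∀ {n} → (Perm n → Set) → Set
IsSubgroupPred {n} P =
  P idP
  × (∀ x y → P x → P y → P (x ∘ₚ y))
  × (∀ x → P x → ∃ λ y → P y × (x ∘ₚ y) ≡ idP)

IsRegular : ∀ {n} → (Perm n → Set) → Set
IsRegular {n} P =
  IsTransitive P × (∀ h → P h → (∃ λ (i : Fin n) → lookup h i ≡ i) → h ≡ idP)

-- Cayley graphs Cay(G,S): vertices the elements of G,
-- g ~ h iff g⁻¹h ∈ S, i.e. iff h = g ∘ d for some d ∈ S.

Adj : ∀ {n} → (Perm n → Set) → Perm n → Perm n → Set
Adj S g h = ∃ λ d → S d × (g ∘ₚ d) ≡ h

SameLeftCoset : ∀ {n} → (Perm n → Set) → Perm n → Perm n → Set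
SameLeftCoset H g h = ∃ λ x → H x × (g ∘ₚ x) ≡ h

IsIndependent : ∀ {n} → List (Perm n) → (Perm n → Set) → List (Perm n) → Set
IsIndependent G S L =
  Unique L × All (_∈ G) L × AllPairs (λ g h → ¬ Adj S g h × ¬ Adj S h g) L

IndependenceNumber≡ : ∀ {n} → List (Perm n) → (Perm n → Set) → ℕ → Set
IndependenceNumber≡ G S k =
  (∃ λ L → IsIndependent G S L × length L ≡ k)
  × (∀ L → IsIndependent G S L → length L ≤ k)

-- Labels.  Two derangements d, e give the same label {d,d⁻¹} iff
-- e = d or d ∘ e = 1 (i.e. e = d⁻¹).  The number of labels of a list D
-- is the number of classes, computed by deduplication.

SameLabel : ∀ {n} → Perm n → Perm n → Set
SameLabel d e = e ≡ d ⊎ (d ∘ₚ e) ≡ idP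

sameLabel? : ∀ {n} (d e : Perm n) → Dec (SameLabel d e)
sameLabel? d e = (e ≟ₚ d) ⊎-dec ((d ∘ₚ e) ≟ₚ idP)

numLabels : ∀ {n} → List (Perm n) → ℕ
numLabels D = length (deduplicate sameLabel? D)

D[_⇒_] : ∀ {n} → Fin n → Fin n → List (Perm n) → List (Perm n)
D[ i ⇒ j ] G = filter (λ d → isDerangement? d ×-dec (lookup d i ≟ j)) G

dG≡ : ∀ {n} → List (Perm n) → ℕ → Set
dG≡ {n} G k =
  (∃ λ (i : Fin n) → ∃ λ (j : Fin n) → i ≢ j × numLabels (D[ i ⇒ j ] G) ≡ k)
  × (∀ (i j : Fin n) → i ≢ j → k ≤ numLabels (D[ i ⇒ j ] G))

-- EKR property and EKR robustness (n ≠ 0 needed for |G|/n)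

HasEKR : ∀ {n} → {{NonZero n}} → List (Perm n) → Set
HasEKR {n} G = IndependenceNumber≡ G (InDer G) (length G / n)

IsInvClosedSubDer : ∀ {n} → List (Perm n) → List (Perm n) → Set
IsInvClosedSubDer G D =
  All (InDer G) D × (∀ {d} → d ∈ D → ∃ λ e → e ∈ D × (d ∘ₚ e) ≡ idP)

DerMinus : ∀ {n} → List (Perm n) → List (Perm n) → Perm n → Set
DerMinus G D d = InDer G d × d ∉ D

IsEKRRobust : ∀ {n} → {{NonZero n}} → List (Perm n) → Set
IsEKRRobust {n} G =
  ∀ k → dG≡ G k →
  ∀ D → IsInvClosedSubDer G D → numLabels D < k →
  IndependenceNumber≡ G (DerMinus G D) (length G / n)

-- H = Der(G) ∪ {1} is semiregular: an element of H with a fixed point is the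
-- identity, so two elements of H that agree at one point are equal.  Hence
-- g ≠ h are adjacent in Γ_G exactly when h ∈ gH, each D_{i→j} has at most one
-- element, and h ↦ h(p) embeds H into [n].  If G is transitive, every element
-- outside H fixes a point, so |G| - |H| ≤ Σᵢ (|Gᵢ| - 1) = |G| - n; thus |H| = n,
-- H is regular and every D_{i→j} is a singleton, so 𝐝_G = 1.  The cliques of
-- Γ_G are the |G|/n left cosets of H, and a transversal of them is a maximum
-- independent set.

module Submission where

open import Defs
open import Data.Nat using (ℕ; zero; suc; _+_; _*_; _≤_; z≤n; s≤s; NonZero; _/_)
open import Data.Nat.Properties
  using (≤-refl; ≤-reflexive; ≤-trans; ≤-antisym; +-assoc; +-comm; +-suc; +-monoʳ-≤;
         +-mono-≤; +-cancelʳ-≤; *-cancelʳ-≤; n≢0⇒n>0; +-0-commutativeMonoid; module ≤-Reasoning)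
import Data.Nat.Properties as ℕ
open import Data.Nat.DivMod using (m*n/n≡m)
open import Data.Fin using (Fin; zero; suc; _≟_)
import Data.Fin.Properties as Fin
open import Data.Vec using (lookup)
import Data.Vec.Properties as Vec
open import Data.List using (List; []; _∷_; _++_; length; map; filter; concat; cartesianProduct; deduplicate)
import Data.List as List
open import Data.List.Properties using (length-map; length-++; length-tabulate; filter-none)
open import Data.List.Membership.Propositional using (_∈_; find; lose)
open import Data.List.Membership.Propositional.Properties
open import Data.List.Relation.Binary.Subset.Propositional using (_⊆_)
open import Data.List.Relation.Binary.Disjoint.Propositional using (Disjoint)
open import Data.List.Relation.Unary.Any using (here; there; any?)
import Data.List.Relation.Unary.Any as Any
import Data.List.Relation.Unary.Any.Properties as Any
open import Data.List.Relation.Unary.All using (All; []; _∷_)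
import Data.List.Relation.Unary.All as All
import Data.List.Relation.Unary.All.Properties as All
open import Data.List.Relation.Unary.AllPairs using (AllPairs; []; _∷_)
import Data.List.Relation.Unary.AllPairs as AllPairs
import Data.List.Relation.Unary.AllPairs.Properties as AllPairs
open import Data.List.Relation.Unary.Unique.Propositional using (Unique)
import Data.List.Relation.Unary.Unique.Propositional.Properties as Unique
open import Algebra.Properties.CommutativeMonoid.Sum +-0-commutativeMonoid using (sum; ∑-distrib-+)
open import Data.Product using (∃; _×_; _,_; proj₁; proj₂; uncurry)
open import Data.Sum using (_⊎_; inj₁; inj₂)
open import Data.Empty using (⊥-elim)
open import Function.Base using (_∘_)
open import Function.Bundles using (_⇔_; mk⇔; module Equivalence)
open import Function.Construct.Identity using (⇔-id)
open import Relation.Binary.Core using (Rel)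
open import Relation.Nullary using (¬_; yes; no; ¬?)
open import Relation.Nullary.Decidable using (_×-dec_; _⊎-dec_)
import Relation.Unary as Unary
import Relation.Binary.Definitions as Binary
open import Relation.Binary.PropositionalEquality
open import Level using (Level)

private
  variable
    a b ℓ : Level
    A : Set a
    B : Set b

Unique-map⁺ : (f : A → B) {xs : List A} →
              (∀ {x y} → x ∈ xs → y ∈ xs → f x ≡ f y → x ≡ y) →
              Unique xs → Unique (map f xs)
Unique-map⁺ f {xs = []} _ [] = []
Unique-map⁺ f {xs = x ∷ xs} inj (x∉xs ∷ xs!) =
  All.map⁺ (All.tabulate λ y∈ fx≡fy → All.lookup x∉xs y∈ (inj (here refl) (there y∈) fx≡fy))
    ∷ Unique-map⁺ f (λ x∈ y∈ → inj (there x∈) (there y∈)) xs!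

Unique-⊆⇒length≤ : ∀ {xs ys : List A} → Unique xs → xs ⊆ ys → length xs ≤ length ys
Unique-⊆⇒length≤ {xs = []} _ _ = z≤n
Unique-⊆⇒length≤ {xs = x ∷ xs} (x∉xs ∷ xs!) xs⊆ys with ∈-∃++ (xs⊆ys (here refl))
... | ys₁ , ys₂ , refl = begin
  suc (length xs)                  ≤⟨ s≤s (Unique-⊆⇒length≤ xs! xs⊆ys₁++ys₂) ⟩
  suc (length (ys₁ ++ ys₂))        ≡⟨ cong suc (length-++ ys₁) ⟩
  suc (length ys₁ + length ys₂)    ≡⟨ +-suc (length ys₁) (length ys₂) ⟨
  length ys₁ + length (x ∷ ys₂)    ≡⟨ length-++ ys₁ ⟨
  length (ys₁ ++ x ∷ ys₂)          ∎
  where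
    open ≤-Reasoning
    xs⊆ys₁++ys₂ : xs ⊆ ys₁ ++ ys₂
    xs⊆ys₁++ys₂ {y} y∈xs with ∈-++⁻ ys₁ (xs⊆ys (there y∈xs))
    ... | inj₁ y∈ys₁         = ∈-++⁺ˡ y∈ys₁
    ... | inj₂ (here refl)   = ⊥-elim (All.lookup x∉xs y∈xs refl)
    ... | inj₂ (there y∈ys₂) = ∈-++⁺ʳ ys₁ y∈ys₂

injection⇒length≤ : (f : A → B) {xs : List A} {ys : List B} →
                    Unique xs → (∀ {x} → x ∈ xs → f x ∈ ys) →
                    (∀ {x y} → x ∈ xs → y ∈ xs → f x ≡ f y → x ≡ y) →
                    length xs ≤ length ys
injection⇒length≤ f {xs} xs! f∈ys inj =
  subst (_≤ _) (length-map f xs) (Unique-⊆⇒length≤ (Unique-map⁺ f inj xs!) fxs⊆ys)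
  where
    fxs⊆ys : map f xs ⊆ _
    fxs⊆ys fx∈ with ∈-map⁻ f fx∈
    ... | x , x∈xs , refl = f∈ys x∈xs

length-cartesianProduct : (xs : List A) (ys : List B) →
                          length (cartesianProduct xs ys) ≡ length xs * length ys
length-cartesianProduct [] ys = refl
length-cartesianProduct (x ∷ xs) ys =
  trans (length-++ (map (x ,_) ys)) (cong₂ _+_ (length-map _ ys) (length-cartesianProduct xs ys))

length-concat-tabulate : ∀ {n} (F : Fin n → List A) → length (concat (List.tabulate F)) ≡ sum (length ∘ F)
length-concat-tabulate {n = zero} F = refl
length-concat-tabulate {n = suc n} F =
  trans (length-++ (F zero)) (cong (length (F zero) +_) (length-concat-tabulate (F ∘ suc)))

length-deduplicate-constant : {R : Rel A ℓ} (R? : Binary.Decidable R) → Binary.Reflexive R →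
                              {xs : List A} → (∀ {x y} → x ∈ xs → y ∈ xs → x ≡ y) →
                              length (deduplicate R? xs) ≤ 1
length-deduplicate-constant R? R-refl {xs = []} _ = z≤n
length-deduplicate-constant {R = R} R? R-refl {xs = x ∷ xs} constant =
  ≤-reflexive (cong (suc ∘ length) (filter-none (¬? ∘ R? x) (All.tabulate λ y∈ ¬Rxy →
    ¬Rxy (subst (R x) (constant (here refl) (there (∈-deduplicate⁻ R? xs y∈))) R-refl))))

length-deduplicate-nonempty : ∀ {R : Rel A ℓ} (R? : Binary.Decidable R) {x xs} → x ∈ xs →
                              1 ≤ length (deduplicate R? xs)
length-deduplicate-nonempty R? (here _)  = s≤s z≤n
length-deduplicate-nonempty R? (there _) = s≤s z≤n

deduplicate-pairwise : {R : Rel A ℓ} (R? : Binary.Decidable R) (xs : List A) →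
                       AllPairs (λ x y → ¬ R x y) (deduplicate R? xs)
deduplicate-pairwise R? [] = []
deduplicate-pairwise R? (x ∷ xs) =
  All.all-filter (¬? ∘ R? x) (deduplicate R? xs) ∷ AllPairs.filter⁺ (¬? ∘ R? x) (deduplicate-pairwise R? xs)

AllPairs-lookup : ∀ {R : Rel A ℓ} {xs : List A} {x y} → AllPairs R xs →
                  x ∈ xs → y ∈ xs → x ≢ y → R x y ⊎ R y x
AllPairs-lookup (_ ∷ _) (here refl) (here refl) x≢y = ⊥-elim (x≢y refl)
AllPairs-lookup (Rx ∷ _) (here refl) (there y∈) _ = inj₁ (All.lookup Rx y∈)
AllPairs-lookup (Rx ∷ _) (there x∈) (here refl) _ = inj₂ (All.lookup Rx x∈)
AllPairs-lookup (_ ∷ xs!) (there x∈) (there y∈) x≢y = AllPairs-lookup xs! x∈ y∈ x≢y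

Unique-full⇒∈ : ∀ {n} {xs : List (Fin n)} → Unique xs → n ≤ length xs → ∀ j → j ∈ xs
Unique-full⇒∈ {n} {xs} xs! n≤|xs| j with any? (j ≟_) xs
... | yes j∈xs = j∈xs
... | no j∉xs = ⊥-elim (ℕ.<⇒≱ (s≤s n≤|xs|) (subst (suc (length xs) ≤_) (length-tabulate (λ i → i))
        (Unique-⊆⇒length≤ (All.¬Any⇒All¬ xs j∉xs ∷ xs!) (λ {i} _ → ∈-allFin i))))

sum-mono-≤ : ∀ {n} {f g : Fin n → ℕ} → (∀ i → f i ≤ g i) → sum f ≤ sum g
sum-mono-≤ {zero} _ = z≤n
sum-mono-≤ {suc n} f≤g = +-mono-≤ (f≤g zero) (sum-mono-≤ (f≤g ∘ suc))

sum-ones : ∀ n → sum {n} (λ _ → 1) ≡ n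
sum-ones zero = refl
sum-ones (suc n) = cong suc (sum-ones n)

module _ {n : ℕ} where

  lookup-∘ₚ : (p q : Perm n) (i : Fin n) → lookup (p ∘ₚ q) i ≡ lookup p (lookup q i)
  lookup-∘ₚ p q = Vec.lookup∘tabulate _

  lookup-idP : (i : Fin n) → lookup (idP {n}) i ≡ i
  lookup-idP = Vec.lookup-allFin

  Perm-ext : {p q : Perm n} → (∀ i → lookup p i ≡ lookup q i) → p ≡ q
  Perm-ext {p} {q} p≗q =
    trans (sym (Vec.tabulate∘lookup p)) (trans (Vec.tabulate-cong p≗q) (Vec.tabulate∘lookup q))

  ∘ₚ-identityˡ : (p : Perm n) → idP ∘ₚ p ≡ p
  ∘ₚ-identityˡ p = Perm-ext λ i → trans (lookup-∘ₚ idP p i) (lookup-idP _)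

  ∘ₚ-identityʳ : (p : Perm n) → p ∘ₚ idP ≡ p
  ∘ₚ-identityʳ p = Perm-ext λ i → trans (lookup-∘ₚ p idP i) (cong (lookup p) (lookup-idP i))

  ∘ₚ-assoc : (p q r : Perm n) → (p ∘ₚ q) ∘ₚ r ≡ p ∘ₚ (q ∘ₚ r)
  ∘ₚ-assoc p q r = Perm-ext λ i → begin
    lookup ((p ∘ₚ q) ∘ₚ r) i          ≡⟨ lookup-∘ₚ (p ∘ₚ q) r i ⟩
    lookup (p ∘ₚ q) (lookup r i)       ≡⟨ lookup-∘ₚ p q (lookup r i) ⟩
    lookup p (lookup q (lookup r i))   ≡⟨ cong (lookup p) (lookup-∘ₚ q r i) ⟨
    lookup p (lookup (q ∘ₚ r) i)       ≡⟨ lookup-∘ₚ p (q ∘ₚ r) i ⟨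
    lookup (p ∘ₚ (q ∘ₚ r)) i           ∎
    where open ≡-Reasoning

  inverseʳ⇒inverseˡ : (p q : Perm n) → IsPerm p → p ∘ₚ q ≡ idP → q ∘ₚ p ≡ idP
  inverseʳ⇒inverseˡ p q p-injective pq≡id = Perm-ext λ i →
    trans (lookup-∘ₚ q p i) (trans (p-injective _ _ (p[q[pi]]≡pi i)) (sym (lookup-idP i)))
    where
      p[q[pi]]≡pi : ∀ i → lookup p (lookup q (lookup p i)) ≡ lookup p i
      p[q[pi]]≡pi i = trans (sym (lookup-∘ₚ p q _)) (trans (cong (λ r → lookup r (lookup p i)) pq≡id) (lookup-idP _))

  ∘ₚ-cancelˡ : {p q x y : Perm n} → q ∘ₚ p ≡ idP → p ∘ₚ x ≡ p ∘ₚ y → x ≡ y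
  ∘ₚ-cancelˡ {p} {q} {x} {y} qp≡id px≡py = begin
    x                ≡⟨ ∘ₚ-identityˡ x ⟨
    idP ∘ₚ x         ≡⟨ cong (_∘ₚ x) qp≡id ⟨
    (q ∘ₚ p) ∘ₚ x    ≡⟨ ∘ₚ-assoc q p x ⟩
    q ∘ₚ (p ∘ₚ x)    ≡⟨ cong (q ∘ₚ_) px≡py ⟩
    q ∘ₚ (p ∘ₚ y)    ≡⟨ ∘ₚ-assoc q p y ⟨
    (q ∘ₚ p) ∘ₚ y    ≡⟨ cong (_∘ₚ y) qp≡id ⟩
    idP ∘ₚ y         ≡⟨ ∘ₚ-identityˡ y ⟩
    y                ∎
    where open ≡-Reasoning

  ∘ₚ-cancelʳ : {p q x y : Perm n} → p ∘ₚ q ≡ idP → x ∘ₚ p ≡ y ∘ₚ p → x ≡ y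
  ∘ₚ-cancelʳ {p} {q} {x} {y} pq≡id xp≡yp = begin
    x                ≡⟨ ∘ₚ-identityʳ x ⟨
    x ∘ₚ idP         ≡⟨ cong (x ∘ₚ_) pq≡id ⟨
    x ∘ₚ (p ∘ₚ q)    ≡⟨ ∘ₚ-assoc x p q ⟨
    (x ∘ₚ p) ∘ₚ q    ≡⟨ cong (_∘ₚ q) xp≡yp ⟩
    (y ∘ₚ p) ∘ₚ q    ≡⟨ ∘ₚ-assoc y p q ⟩
    y ∘ₚ (p ∘ₚ q)    ≡⟨ cong (y ∘ₚ_) pq≡id ⟩
    y ∘ₚ idP         ≡⟨ ∘ₚ-identityʳ y ⟩
    y                ∎
    where open ≡-Reasoning

module DerangementSubgroup {n : ℕ} (G : List (Perm n)) (G-group : IsPermGroup G)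
                           (H-subgroup : IsSubgroupPred (InH G)) where

  open IsPermGroup G-group
  open import Data.List.Membership.DecPropositional (_≟ₚ_ {n}) using (_∈?_)

  inverse : ∀ {g} → g ∈ G → ∃ λ g⁻¹ → g ∘ₚ g⁻¹ ≡ idP × g⁻¹ ∘ₚ g ≡ idP
  inverse {g} g∈G with inv∈ g∈G
  ... | g⁻¹ , _ , gg⁻¹≡id = g⁻¹ , gg⁻¹≡id , inverseʳ⇒inverseˡ g g⁻¹ (All.lookup perms g∈G) gg⁻¹≡id

  InH? : Unary.Decidable (InH G)
  InH? x = (x ≟ₚ idP) ⊎-dec ((x ∈? G) ×-dec isDerangement? x)

  H : List (Perm n)
  H = filter InH? G

  H-unique : Unique H
  H-unique = Unique.filter⁺ InH? unique

  InH⇒∈G : ∀ {x} → InH G x → x ∈ G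
  InH⇒∈G (inj₁ refl)       = id∈
  InH⇒∈G (inj₂ (x∈G , _)) = x∈G

  InH⇒∈H : ∀ {x} → InH G x → x ∈ H
  InH⇒∈H x∈H = ∈-filter⁺ InH? (InH⇒∈G x∈H) x∈H

  ∈H⇒InH : ∀ {x} → x ∈ H → InH G x
  ∈H⇒InH x∈H = proj₂ (∈-filter⁻ InH? {xs = G} x∈H)

  InH-∘ₚ : ∀ {x y} → InH G x → InH G y → InH G (x ∘ₚ y)
  InH-∘ₚ = proj₁ (proj₂ H-subgroup) _ _

  InH-inverse : ∀ {x} → InH G x → ∃ λ x⁻¹ → InH G x⁻¹ × x ∘ₚ x⁻¹ ≡ idP × x⁻¹ ∘ₚ x ≡ idP
  InH-inverse {x} x∈H with proj₂ (proj₂ H-subgroup) x x∈H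
  ... | x⁻¹ , x⁻¹∈H , xx⁻¹≡id =
    x⁻¹ , x⁻¹∈H , xx⁻¹≡id , inverseʳ⇒inverseˡ x x⁻¹ (All.lookup perms (InH⇒∈G x∈H)) xx⁻¹≡id

  InH-fixedPoint⇒≡idP : ∀ {h} → InH G h → ∀ i → lookup h i ≡ i → h ≡ idP
  InH-fixedPoint⇒≡idP (inj₁ h≡id)         _ _    = h≡id
  InH-fixedPoint⇒≡idP (inj₂ (_ , h-der)) i hi≡i = ⊥-elim (h-der i hi≡i)

  InH-agree⇒≡ : ∀ {h h'} → InH G h → InH G h' → ∀ i → lookup h i ≡ lookup h' i → h ≡ h'
  InH-agree⇒≡ {h} {h'} h∈H h'∈H i hi≡h'i with InH-inverse h'∈H
  ... | y , y∈H , h'y≡id , yh'≡id = begin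
    h                 ≡⟨ ∘ₚ-identityˡ h ⟨
    idP ∘ₚ h          ≡⟨ cong (_∘ₚ h) h'y≡id ⟨
    (h' ∘ₚ y) ∘ₚ h    ≡⟨ ∘ₚ-assoc h' y h ⟩
    h' ∘ₚ (y ∘ₚ h)    ≡⟨ cong (h' ∘ₚ_) yh≡id ⟩
    h' ∘ₚ idP         ≡⟨ ∘ₚ-identityʳ h' ⟩
    h'                ∎
    where
      open ≡-Reasoning
      yh≡id : y ∘ₚ h ≡ idP
      yh≡id = InH-fixedPoint⇒≡idP (InH-∘ₚ y∈H h∈H) i (begin
        lookup (y ∘ₚ h) i        ≡⟨ lookup-∘ₚ y h i ⟩
        lookup y (lookup h i)    ≡⟨ cong (lookup y) hi≡h'i ⟩
        lookup y (lookup h' i)   ≡⟨ lookup-∘ₚ y h' i ⟨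
        lookup (y ∘ₚ h') i       ≡⟨ cong (λ p → lookup p i) yh'≡id ⟩
        lookup idP i             ≡⟨ lookup-idP i ⟩
        i                        ∎)

  _≈H_ : Perm n → Perm n → Set
  _≈H_ = SameLeftCoset (InH G)

  ≈H-refl : ∀ g → g ≈H g
  ≈H-refl g = idP , inj₁ refl , ∘ₚ-identityʳ g

  ≈H-sym : ∀ {g h} → g ≈H h → h ≈H g
  ≈H-sym {g} {h} (x , x∈H , gx≡h) with InH-inverse x∈H
  ... | x⁻¹ , x⁻¹∈H , xx⁻¹≡id , _ = x⁻¹ , x⁻¹∈H , (begin
    h ∘ₚ x⁻¹           ≡⟨ cong (_∘ₚ x⁻¹) gx≡h ⟨
    (g ∘ₚ x) ∘ₚ x⁻¹    ≡⟨ ∘ₚ-assoc g x x⁻¹ ⟩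
    g ∘ₚ (x ∘ₚ x⁻¹)    ≡⟨ cong (g ∘ₚ_) xx⁻¹≡id ⟩
    g ∘ₚ idP           ≡⟨ ∘ₚ-identityʳ g ⟩
    g                  ∎)
    where open ≡-Reasoning

  ≈H-trans : ∀ {g h k} → g ≈H h → h ≈H k → g ≈H k
  ≈H-trans {g} (x , x∈H , refl) (y , y∈H , refl) = x ∘ₚ y , InH-∘ₚ x∈H y∈H , sym (∘ₚ-assoc g x y)

  _≈H?_ : Binary.Decidable _≈H_
  g ≈H? h with any? (λ x → (g ∘ₚ x) ≟ₚ h) H
  ... | yes gx≡h = let x , x∈H , gx≡h = find gx≡h in yes (x , ∈H⇒InH x∈H , gx≡h)
  ... | no ∄x = no λ (x , x∈H , gx≡h) → ∄x (lose (InH⇒∈H x∈H) gx≡h)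

  ∈D⇒InDer : ∀ {i j d} → d ∈ D[ i ⇒ j ] G → InDer G d × lookup d i ≡ j
  ∈D⇒InDer {i} {j} d∈D with ∈-filter⁻ (λ d → isDerangement? d ×-dec (lookup d i ≟ j)) {xs = G} d∈D
  ... | d∈G , d-der , di≡j = (d∈G , d-der) , di≡j

  numLabels-D≤1 : ∀ i j → numLabels (D[ i ⇒ j ] G) ≤ 1
  numLabels-D≤1 i j = length-deduplicate-constant sameLabel? (inj₁ refl) λ d∈D e∈D →
    let d∈Der , di≡j = ∈D⇒InDer d∈D
        e∈Der , ei≡j = ∈D⇒InDer e∈D
    in InH-agree⇒≡ (inj₂ d∈Der) (inj₂ e∈Der) i (trans di≡j (sym ei≡j))

  dG≤1 : (i₀ j₀ : Fin n) → i₀ ≢ j₀ → ∃ λ k → dG≡ G k × k ≤ 1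
  dG≤1 i₀ j₀ i₀≢j₀
    with Fin.any? (λ i → Fin.any? (λ j → ¬? (i ≟ j) ×-dec (numLabels (D[ i ⇒ j ] G) ℕ.≟ 0)))
  ... | yes (i , j , i≢j , none) = 0 , ((i , j , i≢j , none) , λ _ _ _ → z≤n) , z≤n
  ... | no ∄none = 1 , ((i₀ , j₀ , i₀≢j₀ , ≤-antisym (numLabels-D≤1 i₀ j₀) (nonzero i₀ j₀ i₀≢j₀)) , nonzero) , ≤-refl
    where
      nonzero : ∀ i j → i ≢ j → 1 ≤ numLabels (D[ i ⇒ j ] G)
      nonzero i j i≢j = n≢0⇒n>0 λ none → ∄none (i , j , i≢j , none)

  PartialTransversal : List (Perm n) → Set
  PartialTransversal L = ∀ {g g'} → g ∈ L → g' ∈ L → g ≈H g' → g ≡ g'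

  partialTransversal⇒|L|*|H|≤|G| : ∀ {L} → Unique L → PartialTransversal L → L ⊆ G → length L * length H ≤ length G
  partialTransversal⇒|L|*|H|≤|G| {L} L! L-sep L⊆G = subst (_≤ length G) (length-cartesianProduct L H)
    (injection⇒length≤ (uncurry _∘ₚ_) (Unique.cartesianProduct⁺ L! H-unique)
      ∘ₚ∈G ∘ₚ-injective)
    where
      ∘ₚ∈G : ∀ {p} → p ∈ cartesianProduct L H → uncurry _∘ₚ_ p ∈ G
      ∘ₚ∈G {g , x} p∈ = let g∈L , x∈H = ∈-cartesianProduct⁻ L H p∈ in comp∈ (L⊆G g∈L) (InH⇒∈G (∈H⇒InH x∈H))
      ∘ₚ-injective : ∀ {p q} → p ∈ cartesianProduct L H → q ∈ cartesianProduct L H →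
                     uncurry _∘ₚ_ p ≡ uncurry _∘ₚ_ q → p ≡ q
      ∘ₚ-injective {g , x} {g' , x'} p∈ q∈ gx≡g'x'
        with ∈-cartesianProduct⁻ L H p∈ | ∈-cartesianProduct⁻ L H q∈
      ... | g∈L , x∈H | g'∈L , x'∈H
        with L-sep g∈L g'∈L (≈H-trans {g} (x , ∈H⇒InH x∈H , gx≡g'x') (≈H-sym {g'} (x' , ∈H⇒InH x'∈H , refl)))
      ... | refl with inverse (L⊆G g∈L)
      ...   | g⁻¹ , _ , g⁻¹g≡id = cong (g ,_) (∘ₚ-cancelˡ {p = g} {q = g⁻¹} g⁻¹g≡id gx≡g'x')

  transversal : List (Perm n)
  transversal = deduplicate _≈H?_ G

  transversal-unique : Unique transversal
  transversal-unique = AllPairs.map (λ {g} g≉g' g≡g' → g≉g' (subst (g ≈H_) g≡g' (≈H-refl g)))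
    (deduplicate-pairwise _≈H?_ G)

  transversal-partial : PartialTransversal transversal
  transversal-partial {g} {g'} g∈T g'∈T g≈g' with g ≟ₚ g'
  ... | yes g≡g' = g≡g'
  ... | no g≢g' with AllPairs-lookup (deduplicate-pairwise _≈H?_ G) g∈T g'∈T g≢g'
  ...   | inj₁ g≉g' = ⊥-elim (g≉g' g≈g')
  ...   | inj₂ g'≉g = ⊥-elim (g'≉g (≈H-sym g≈g'))

  |G|≤|transversal|*|H| : length G ≤ length transversal * length H
  |G|≤|transversal|*|H| =
    subst (length G ≤_) (trans (length-map _ (cartesianProduct transversal H)) (length-cartesianProduct transversal H))
      (Unique-⊆⇒length≤ unique G⊆cosets)
    where
      G⊆cosets : G ⊆ map (uncurry _∘ₚ_) (cartesianProduct transversal H)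
      G⊆cosets {g} g∈G
        with find (Any.deduplicate⁺ _≈H?_ (λ {r} {r'} → ≈H-trans {r'}) (Any.map (λ { refl → ≈H-refl g }) g∈G))
      ... | r , r∈T , x , x∈H , rx≡g =
        subst (_∈ _) rx≡g (∈-map⁺ (uncurry _∘ₚ_) (∈-cartesianProduct⁺ r∈T (InH⇒∈H x∈H)))

  |transversal|*|H|≡|G| : length transversal * length H ≡ length G
  |transversal|*|H|≡|G| = ≤-antisym
    (partialTransversal⇒|L|*|H|≤|G| transversal-unique transversal-partial (∈-deduplicate⁻ _≈H?_ G)) |G|≤|transversal|*|H|

  module _ {S : Perm n → Set} (S⇔Der : ∀ d → S d ⇔ InDer G d) where

    Adj⇒≈H : ∀ {g h} → Adj S g h → g ≈H h
    Adj⇒≈H (d , Sd , gd≡h) = d , inj₂ (Equivalence.to (S⇔Der d) Sd) , gd≡h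

    Adj⇔≈H : ∀ {g h} → g ≢ h → Adj S g h ⇔ g ≈H h
    Adj⇔≈H {g} {h} g≢h = mk⇔ (Adj⇒≈H {g}) ≈H⇒Adj
      where
        ≈H⇒Adj : g ≈H h → Adj S g h
        ≈H⇒Adj (_ , inj₁ refl , g≡h)      = ⊥-elim (g≢h (trans (sym (∘ₚ-identityʳ g)) g≡h))
        ≈H⇒Adj (x , inj₂ x∈Der , gx≡h) = x , Equivalence.from (S⇔Der x) x∈Der , gx≡h

    independent⇒partialTransversal : ∀ {L} → IsIndependent G S L → PartialTransversal L
    independent⇒partialTransversal (_ , _ , L-indep) {g} {g'} g∈L g'∈L g≈g' with g ≟ₚ g'
    ... | yes g≡g' = g≡g'
    ... | no g≢g' with AllPairs-lookup L-indep g∈L g'∈L g≢g'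
    ...   | inj₁ (¬g~g' , _) = ⊥-elim (¬g~g' (Equivalence.from (Adj⇔≈H g≢g') g≈g'))
    ...   | inj₂ (_ , ¬g~g') = ⊥-elim (¬g~g' (Equivalence.from (Adj⇔≈H g≢g') g≈g'))

    transversal-independent : IsIndependent G S transversal
    transversal-independent =
      transversal-unique ,
      All.tabulate (∈-deduplicate⁻ _≈H?_ G) ,
      AllPairs.map (λ {g} {g'} g≉g' → g≉g' ∘ Adj⇒≈H {g} , g≉g' ∘ ≈H-sym {g'} ∘ Adj⇒≈H {g'}) (deduplicate-pairwise _≈H?_ G)

    independenceNumber≡|G|/|H| : ∀ m .{{_ : NonZero m}} → length H ≡ m → IndependenceNumber≡ G S (length G / m)
    independenceNumber≡|G|/|H| _ refl =
      (transversal , transversal-independent , sym |G|/|H|≡|transversal|) ,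
      λ L L-indep@(L! , L⊆G , _) → subst (length L ≤_) (sym |G|/|H|≡|transversal|)
        (*-cancelʳ-≤ (length L) (length transversal) (length H)
          (subst (length L * length H ≤_) (sym |transversal|*|H|≡|G|)
            (partialTransversal⇒|L|*|H|≤|G| L! (independent⇒partialTransversal L-indep) (All.lookup L⊆G))))
      where
        |G|/|H|≡|transversal| : length G / length H ≡ length transversal
        |G|/|H|≡|transversal| = trans (cong (_/ length H) (sym |transversal|*|H|≡|G|)) (m*n/n≡m (length transversal) (length H))

  nontrivialStabilizer : Fin n → List (Perm n)
  nontrivialStabilizer i = filter (λ g → (lookup g i ≟ i) ×-dec ¬? (g ≟ₚ idP)) G

  G⊆H++nontrivialStabilizers : G ⊆ H ++ concat (List.tabulate nontrivialStabilizer)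
  G⊆H++nontrivialStabilizers {g} g∈G with InH? g
  ... | yes g∈H = ∈-++⁺ˡ (InH⇒∈H g∈H)
  ... | no g∉H with Fin.any? (λ i → lookup g i ≟ i)
  ...   | yes (i , gi≡i) =
    ∈-++⁺ʳ H (∈-concat⁺′ (∈-filter⁺ _ g∈G (gi≡i , g∉H ∘ inj₁)) (∈-tabulate⁺ i))
  ...   | no ∄fixed = ⊥-elim (g∉H (inj₂ (g∈G , λ i gi≡i → ∄fixed (i , gi≡i))))

  fibre : Fin n → Fin n → List (Perm n)
  fibre p i = filter (λ g → lookup g p ≟ i) G

  ∑|fibre|≤|G| : ∀ p → sum (length ∘ fibre p) ≤ length G
  ∑|fibre|≤|G| p = subst (_≤ length G) (length-concat-tabulate (fibre p))
    (Unique-⊆⇒length≤ (Unique.concat⁺ (All.tabulate⁺ λ i → Unique.filter⁺ _ unique) (AllPairs.tabulate⁺ disjoint)) fibres⊆G)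
    where
      disjoint : ∀ {i j} → i ≢ j → Disjoint (fibre p i) (fibre p j)
      disjoint i≢j (g∈i , g∈j) = i≢j (trans (sym (proj₂ (∈-filter⁻ _ {xs = G} g∈i))) (proj₂ (∈-filter⁻ _ {xs = G} g∈j)))
      fibres⊆G : concat (List.tabulate (fibre p)) ⊆ G
      fibres⊆G g∈ with ∈-concat⁻′ (List.tabulate (fibre p)) g∈
      ... | xs , g∈xs , xs∈ with ∈-tabulate⁻ xs∈
      ...   | i , refl = proj₁ (∈-filter⁻ _ {xs = G} g∈xs)

  image : Fin n → List (Fin n)
  image p = map (λ h → lookup h p) H

  image-unique : ∀ p → Unique (image p)
  image-unique p = Unique-map⁺ _ (λ h∈H h'∈H → InH-agree⇒≡ (∈H⇒InH h∈H) (∈H⇒InH h'∈H) p) H-unique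

  |H|≤n : Fin n → length H ≤ n
  |H|≤n p = subst₂ _≤_ (length-map _ H) (length-tabulate (λ i → i))
    (Unique-⊆⇒length≤ (image-unique p) (λ {i} _ → ∈-allFin i))

  module Transitive (G-transitive : IsTransitive (_∈ G)) where

    1+|nontrivialStabilizer|≤|fibre| : ∀ p i → suc (length (nontrivialStabilizer i)) ≤ length (fibre p i)
    1+|nontrivialStabilizer|≤|fibre| p i with G-transitive p i
    ... | t , t∈G , tp≡i with inverse t∈G
    ...   | t⁻¹ , tt⁻¹≡id , _ =
      injection⇒length≤ (_∘ₚ t) stabilizer-unique ∘t∈fibre (λ _ _ → ∘ₚ-cancelʳ {p = t} {q = t⁻¹} tt⁻¹≡id)
      where
        stabilizer-unique : Unique (idP ∷ nontrivialStabilizer i)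
        stabilizer-unique =
          All.tabulate (λ g∈ id≡g → proj₂ (proj₂ (∈-filter⁻ _ {xs = G} g∈)) (sym id≡g)) ∷ Unique.filter⁺ _ unique
        stabilizes : ∀ {x} → x ∈ idP ∷ nontrivialStabilizer i → x ∈ G × lookup x i ≡ i
        stabilizes (here refl) = id∈ , lookup-idP i
        stabilizes (there x∈) = let x∈G , xi≡i , _ = ∈-filter⁻ _ {xs = G} x∈ in x∈G , xi≡i
        ∘t∈fibre : ∀ {x} → x ∈ idP ∷ nontrivialStabilizer i → x ∘ₚ t ∈ fibre p i
        ∘t∈fibre {x} x∈ = let x∈G , xi≡i = stabilizes x∈ in
          ∈-filter⁺ _ (comp∈ x∈G t∈G) (trans (lookup-∘ₚ x t p) (trans (cong (lookup x) tp≡i) xi≡i))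

    -- G ⊆ H ∪ ⋃ᵢ (Gᵢ ∖ {1}), and right multiplication by some t with t(p) = i
    -- embeds Gᵢ into the fibre {g | g(p) = i}; the fibres partition G.
    n≤|H| : Fin n → n ≤ length H
    n≤|H| p = +-cancelʳ-≤ (length G) n (length H) (begin
      n + length G
        ≤⟨ +-monoʳ-≤ n (Unique-⊆⇒length≤ unique G⊆H++nontrivialStabilizers) ⟩
      n + length (H ++ concat (List.tabulate nontrivialStabilizer))
        ≡⟨ cong (n +_) (trans (length-++ H) (cong (length H +_) (length-concat-tabulate nontrivialStabilizer))) ⟩
      n + (length H + ∑stab)
        ≡⟨ trans (sym (+-assoc n _ _)) (trans (cong (_+ ∑stab) (+-comm n _)) (+-assoc (length H) n _)) ⟩
      length H + (n + ∑stab)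
        ≡⟨ cong (λ m → length H + (m + ∑stab)) (sum-ones n) ⟨
      length H + (sum {n} (λ _ → 1) + ∑stab)
        ≡⟨ cong (length H +_) (∑-distrib-+ (λ _ → 1) (length ∘ nontrivialStabilizer)) ⟨
      length H + sum (λ i → suc (length (nontrivialStabilizer i)))
        ≤⟨ +-monoʳ-≤ (length H) (sum-mono-≤ (1+|nontrivialStabilizer|≤|fibre| p)) ⟩
      length H + sum (length ∘ fibre p)
        ≤⟨ +-monoʳ-≤ (length H) (∑|fibre|≤|G| p) ⟩
      length H + length G ∎)
      where
        open ≤-Reasoning
        ∑stab : ℕ
        ∑stab = sum (length ∘ nontrivialStabilizer)

    H-transitive : IsTransitive (InH G)
    H-transitive i j with ∈-map⁻ _ (Unique-full⇒∈ (image-unique i) (subst (n ≤_) (sym (length-map _ H)) (n≤|H| i)) j)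
    ... | h , h∈H , j≡hi = h , ∈H⇒InH h∈H , sym j≡hi

    H-regular : IsRegular (InH G)
    H-regular = H-transitive , λ h h∈H (i , hi≡i) → InH-fixedPoint⇒≡idP h∈H i hi≡i

    numLabels-D≡1 : ∀ i j → i ≢ j → numLabels (D[ i ⇒ j ] G) ≡ 1
    numLabels-D≡1 i j i≢j with H-transitive i j
    ... | _ , inj₁ refl , i≡j = ⊥-elim (i≢j (trans (sym (lookup-idP i)) i≡j))
    ... | _ , inj₂ (h∈G , h-der) , hi≡j = ≤-antisym (numLabels-D≤1 i j)
      (length-deduplicate-nonempty sameLabel? (∈-filter⁺ _ h∈G (h-der , hi≡j)))

    dG≡1 : (i₀ j₀ : Fin n) → i₀ ≢ j₀ → dG≡ G 1
    dG≡1 i₀ j₀ i₀≢j₀ = (i₀ , j₀ , i₀≢j₀ , numLabels-D≡1 i₀ j₀ i₀≢j₀) , λ i j i≢j → ≤-reflexive (sym (numLabels-D≡1 i j i≢j))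

    module _ {{_ : NonZero n}} (i₀ j₀ : Fin n) (i₀≢j₀ : i₀ ≢ j₀) where

      |H|≡n : length H ≡ n
      |H|≡n = ≤-antisym (|H|≤n i₀) (n≤|H| i₀)

      EKR : HasEKR G
      EKR = independenceNumber≡|G|/|H| (λ d → ⇔-id (InDer G d)) n |H|≡n

      -- 𝐝_G = 1, so the only admissible D is empty.
      EKR-robust : IsEKRRobust G
      EKR-robust k (_ , k≤d) [] _ _ =
        independenceNumber≡|G|/|H| (λ d → mk⇔ proj₁ (_, λ ())) n |H|≡n
      EKR-robust k (_ , k≤d) (_ ∷ _) _ |D|<k
        with ≤-trans |D|<k (subst (k ≤_) (numLabels-D≡1 i₀ j₀ i₀≢j₀) (k≤d i₀ j₀ i₀≢j₀))
      ... | s≤s ()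

lemma3p2 : (n : ℕ) → 2 ≤ n → {{_ : NonZero n}} →
    (G : List (Perm n)) → IsPermGroup G → IsSubgroupPred (InH G) →
    ((g h : Perm n) → g ∈ G → h ∈ G → g ≢ h →
       (Adj (InDer G) g h ⇔ SameLeftCoset (InH G) g h))
    × (∃ λ k → dG≡ G k × k ≤ 1)
    × (IsTransitive (_∈ G) →
         IsRegular (InH G) × dG≡ G 1 × HasEKR G × IsEKRRobust G)
lemma3p2 (suc (suc _)) (s≤s (s≤s z≤n)) G G-group H-subgroup =
  (λ _ _ _ _ → Adj⇔≈H (λ d → ⇔-id (InDer G d))) ,
  dG≤1 zero (suc zero) (λ ()) ,
  λ G-transitive → let open Transitive G-transitive in
    H-regular , dG≡1 zero (suc zero) (λ ()) , EKR zero (suc zero) (λ ()) , EKR-robust zero (suc zero) (λ ())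
  where open DerangementSubgroup G G-group H-subgroup
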